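{- Let $\mathfrak m$ be a non-orientable precubic unicellular map with $k\ge1$ twists (for its canonical convention), and let $\sigma$ be the permutation of $\{1,\dots,2k\}$ described in the context. Then $\sigma$ maps odd integers to even integers. In particular $r=\sigma^{ -1}(1)$ is even.
   Context: Maps are embeddings of connected finite graphs into compact connected surfaces with simply connected faces, up to homeomorphism, rooted by a distinguished half-edge with a distinguished side (root corner). A corner is an angular sector between consecutive half-edges at a vertex. Unicellular: one face. Precubic: all vertices of degree $1$ or $3$, root vertex of degree $1$. The tour follows the edges from the root corner along the distinguished side until returning, visiting every corner once. An orientation convention is a local orientation near each vertex; a twist is an edge along which the local orientations of the endpoints do not extend consistently; a corner is left if to the left of the walker during the tour, right otherwise; the canonical convention is the one in which every vertex has more left than right corners, and is used throughout (it gives a rotation system, i.e. cyclic order of half-edges at each vertex, and a set of twists). Construction: cut every twist of $\mathfrak m$ at its midpoint; this gives an embedded graph $\widehat{\mathfrak m}$ (rotation system, no twists) with $2k$ dangling half-edges called buds. Faces of $\widehat{\mathfrak m}$ are traversed in the direction in which every corner is on the left. Write the sequence of corners of the tour of $\mathfrak m$ as $w_1w_2\cdots w_{2k+1}$, where consecutive blocks $w_i,w_{i+1}$ are separated by the traversal of a twist. Let $w'_1=w_{2k+1}w_1$, and for $2\le i\le 2k$ let $w'_i=w_i$ if $i$ is odd and $w'_i$ the reverse of $w_i$ if $i$ is even; these are exactly the sequences of corners between consecutive buds around the faces of $\widehat{\mathfrak m}$. Label by $i$ the bud which follows the sequence $w'_i$ around the faces of $\widehat{\mathfrak m}$. For a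 bud $b$, $\sigma(b)$ is the bud following $b$ when turning around the face of $\widehat{\mathfrak m}$ containing $b$. -}

module Defs where

open import Data.Nat using (ℕ; zero; suc; _+_; _*_; _∸_; _<_; _≤_; _%_)
open import Data.Bool using (Bool; true; false; if_then_else_; not; _∧_; _∨_; _xor_)
open import Data.Fin using (Fin; toℕ)
open import Data.Fin.Properties using (_≟_)
open import Data.Fin.Permutation using (Permutation′; _⟨$⟩ʳ_; _⟨$⟩ˡ_)
open import Data.List using (List; []; _∷_; upTo; filterᵇ)
open import Data.Maybe using (Maybe; just; nothing)
open import Data.Product using (Σ; _×_; _,_; proj₁; proj₂)
open import Data.Sum using (_⊎_)
open import Relation.Nullary using (¬_)
open import Relation.Nullary.Decidable using (⌊_⌋)
open import Relation.Binary.PropositionalEquality using (_≡_; _≢_)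

iter : ∀ {A : Set} → (A → A) → ℕ → A → A
iter f zero    x = x
iter f (suc n) x = f (iter f n x)

countᵇ : ∀ {n} → (Fin n → Bool) → ℕ
countᵇ {zero}  p = 0
countᵇ {suc n} p = (if p Fin.zero then 1 else 0) + countᵇ {n} (λ i → p (Fin.suc i))

anyᵇ : ∀ {n} → (Fin n → Bool) → Bool
anyᵇ {zero}  p = false
anyᵇ {suc n} p = p Fin.zero ∨ anyᵇ {n} (λ i → p (Fin.suc i))

nth : ∀ {A : Set} → List A → ℕ → Maybe A
nth []       _       = nothing
nth (x ∷ xs) zero    = just x
nth (x ∷ xs) (suc n) = nth xs n

Odd : ℕ → Set
Odd i = i % 2 ≡ 1

Even : ℕ → Set
Even i = i % 2 ≡ 0

-- Maps as signed rotation systems ----------------------------------------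
-- Half-edges are Fin N.  α is the edge involution (fixed-point free),
-- ρ the rotation system (cycles = vertices; ρ h is the half-edge following h
-- counterclockwise for the chosen local orientation), twist h says whether
-- the edge of h is a twist for the chosen orientation convention.
-- The corner "x" is the angular sector between x and ρ x.

record SignedMap (N : ℕ) : Set where
  field
    α       : Permutation′ N
    ρ       : Permutation′ N
    twist   : Fin N → Bool
    α-invol : ∀ h → α ⟨$⟩ʳ (α ⟨$⟩ʳ h) ≡ h
    α-free  : ∀ h → α ⟨$⟩ʳ h ≢ h
    twist-α : ∀ h → twist (α ⟨$⟩ʳ h) ≡ twist h
    root    : Fin N

module _ {N : ℕ} (M : SignedMap N) where
  open SignedMap M

  a : Fin N → Fin N
  a h = α ⟨$⟩ʳ h

  r : Fin N → Fin N
  r h = ρ ⟨$⟩ʳ h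

  r⁻¹ : Fin N → Fin N
  r⁻¹ h = ρ ⟨$⟩ˡ h

  data Reach : Fin N → Fin N → Set where
    here  : ∀ {x} → Reach x x
    viaα  : ∀ {x y} → Reach (a x) y → Reach x y
    viaρ  : ∀ {x y} → Reach (r x) y → Reach x y

  Connected : Set
  Connected = ∀ x y → Reach x y

  Precubic : Set
  Precubic = (∀ h → (r h ≡ h) ⊎ (r h ≢ h × r (r (r h)) ≡ h)) × (r root ≡ root)

  sameVertexᵇ : Fin N → Fin N → Bool
  sameVertexᵇ y x = anyᵇ {N} (λ i → ⌊ iter r (toℕ i) y ≟ x ⌋)

  -- non-orientable: no choice of local orientations removes all twists
  -- (flipping orientations f : vertices → Bool changes the twist of an edge
  -- uv by f u xor f v)
  NonOrientable : Set
  NonOrientable =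
    ¬ Σ (Fin N → Bool) (λ f → (∀ h → f (r h) ≡ f h) × (∀ h → twist h ≡ f h xor f (a h)))

  -- The tour.  A state (h , s) : the walker is about to traverse half-edge h,
  -- s = true iff it moves in the positive direction of the local orientation
  -- at the vertex of h.
  step : Fin N × Bool → Fin N × Bool
  step (h , s) =
    let s' = if twist h then not s else s
        h' = a h
    in (if s' then r h' else r⁻¹ h') , s'

  -- the tour starts at the root corner (the unique corner at the root leaf),
  -- on its distinguished side, which in the canonical convention is the left
  state : ℕ → Fin N × Bool
  state t = iter step t (root , true)

  edgeAt : ℕ → Fin N
  edgeAt t = proj₁ (state t)

  cornerAt : ℕ → Fin N
  cornerAt t = if proj₂ (state t) then r⁻¹ (proj₁ (state t)) else proj₁ (state t)

  leftAt : ℕ → Bool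
  leftAt t = proj₂ (state t)

  -- one face: the tour visits the N corners once each in its first N steps
  Unicellular : Set
  Unicellular = ∀ (t t' : Fin N) → cornerAt (toℕ t) ≡ cornerAt (toℕ t') → t ≡ t'

  leftCount rightCount : Fin N → ℕ
  leftCount  x = countᵇ {N} (λ t → sameVertexᵇ (cornerAt (toℕ t)) x ∧ leftAt (toℕ t))
  rightCount x = countᵇ {N} (λ t → sameVertexᵇ (cornerAt (toℕ t)) x ∧ not (leftAt (toℕ t)))

  Canonical : Set
  Canonical = ∀ x → rightCount x < leftCount x

  HasTwists : ℕ → Set
  HasTwists k = countᵇ {N} twist ≡ 2 * k

  twistTimes : List ℕ
  twistTimes = filterᵇ (λ t → twist (edgeAt t)) (upTo N)

  -- bud labelled i (1 ≤ i ≤ 2k) in the cut map:  i odd: the half-edge by which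
  -- the tour leaves block w_i (i-th twist traversal); i even: the half-edge by
  -- which the tour enters block w_i (end of the (i-1)-th twist traversal).
  bud : ℕ → Maybe (Fin N)
  bud zero = nothing
  bud (suc j) with (suc j) % 2
  ... | 1 = Data.Maybe.map edgeAt (nth twistTimes j)
  ... | _ = Data.Maybe.map (λ t → a (edgeAt t)) (nth twistTimes (j ∸ 1))

  -- σ : the bud x' following the bud x around its face of the cut map
  -- (faces followed with corners on the left: after x comes corner x, then
  -- half-edge ρ x; an untwisted half-edge y is followed by ρ (α y)).
  NextBud : Fin N → Fin N → Set
  NextBud x x' = Σ ℕ λ j →
    (iter (λ y → r (a y)) j (r x) ≡ x') × (twist x' ≡ true) ×
    (∀ j' → j' < j → twist (iter (λ y → r (a y)) j' (r x)) ≡ false)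

  Sigma : ℕ → ℕ → Set
  Sigma i i' = Σ (Fin N) λ x → Σ (Fin N) λ x' →
    (bud i ≡ just x) × (bud i' ≡ just x') × NextBud x x'

module Submission where

-- An odd bud x is a twist crossed by the tour from a left corner, because an even number of
-- twists has been crossed before. Suppose the bud x' following x around its face of the cut
-- map were odd too. The corner x is then a right corner of the tour: otherwise either both
-- corners x and α x next to the twist would be left corners, which the step across the twist
-- rules out, or α x and the corner where the tour lands after crossing x would be two adjacent
-- right corners at a vertex of degree 1 or 3, which the canonical convention forbids. Running
-- the tour backwards from its visit of the right corner x follows that face along untwisted
-- edges and stays on right corners, so it visits the corner before x' from the right. But the
-- tour leaves through x' from that corner on the left, and it visits every corner only once.

open import Defs
open import Data.Nat using (ℕ; zero; suc; _+_; _*_; _≤_; _<_; z≤n; s≤s)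
open import Data.Nat.Properties
  using (≤-refl; ≤-reflexive; ≤-trans; <⇒≤; ≤-<-trans; <-irrefl; n≤1+n; n<1+n; m<n⇒m<1+n;
         m≤n⇒m<n∨m≡n; suc-injective; +-identityʳ; +-comm; +-assoc; module ≤-Reasoning)
open import Data.Bool using (Bool; true; false; not; _∧_; if_then_else_)
open import Data.Bool.Properties using (¬-not)
open import Data.Fin using (Fin; toℕ; fromℕ<; punchOut)
open import Data.Fin.Properties
  using (_≟_; any?; punchOut-injective; <⇒notInjective; toℕ-fromℕ<; toℕ<n)
import Data.Fin.Properties as Finₚ
open import Data.Fin.Permutation using (inverseʳ; inverseˡ)
open import Data.List using (filterᵇ; applyUpTo)
open import Data.Maybe using (just)
import Data.Maybe as Maybe
open import Data.Product using (∃; _×_; _,_; proj₁; proj₂)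
open import Data.Sum using (_⊎_; inj₁; inj₂)
open import Data.Empty using (⊥; ⊥-elim)
open import Function using (id; case_of_)
open import Function.Definitions using (Injective)
open import Relation.Nullary using (yes; no; contradiction)
open import Relation.Nullary.Decidable using (⌊_⌋; dec-true; isYes≗does)
open import Relation.Binary.PropositionalEquality

iter-order3 : ∀ {A : Set} (f : A → A) → (∀ x → f (f (f x)) ≡ x) →
              ∀ k x → iter f k x ≡ x ⊎ iter f k x ≡ f x ⊎ iter f k x ≡ f (f x)
iter-order3 f f³≡id zero    x = inj₁ refl
iter-order3 f f³≡id (suc k) x with iter-order3 f f³≡id k x
... | inj₁ e        = inj₂ (inj₁ (cong f e))
... | inj₂ (inj₁ e) = inj₂ (inj₂ (cong f e))
... | inj₂ (inj₂ e) = inj₁ (trans (cong f e) (f³≡id x))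

injective⇒surjective : ∀ {n} {f : Fin n → Fin n} → Injective _≡_ _≡_ f → ∀ c → ∃ λ i → f i ≡ c
injective⇒surjective {suc n} {f} f-inj c with any? (λ i → f i ≟ c)
... | yes hit  = hit
... | no  miss = ⊥-elim (<⇒notInjective (n<1+n n) punchOut∘f-injective)
  where
  c≢f : ∀ i → c ≢ f i
  c≢f i e = miss (i , sym e)

  punchOut∘f-injective : Injective _≡_ _≡_ (λ i → punchOut (c≢f i))
  punchOut∘f-injective e = f-inj (punchOut-injective (c≢f _) (c≢f _) e)

⌊≟⌋≡true⇒≡ : ∀ {n} {x y : Fin n} → ⌊ x ≟ y ⌋ ≡ true → x ≡ y
⌊≟⌋≡true⇒≡ {x = x} {y} e with x ≟ y
... | yes x≡y = x≡y

anyᵇ⁺ : ∀ {n} (p : Fin n → Bool) i → p i ≡ true → anyᵇ p ≡ true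
anyᵇ⁺ p Fin.zero    e rewrite e = refl
anyᵇ⁺ p (Fin.suc i) e with p Fin.zero
... | true  = refl
... | false = anyᵇ⁺ (λ j → p (Fin.suc j)) i e

anyᵇ⁻ : ∀ {n} (p : Fin n → Bool) → anyᵇ p ≡ true → ∃ λ i → p i ≡ true
anyᵇ⁻ {suc n} p e with p Fin.zero in e₀
... | true  = Fin.zero , e₀
... | false with i , eᵢ ← anyᵇ⁻ (λ j → p (Fin.suc j)) e = Fin.suc i , eᵢ

1≤countᵇ : ∀ {n} (p : Fin n → Bool) i → p i ≡ true → 1 ≤ countᵇ p
1≤countᵇ p Fin.zero    e rewrite e = s≤s z≤n
1≤countᵇ p (Fin.suc i) e with p Fin.zero
... | true  = s≤s z≤n
... | false = 1≤countᵇ (λ j → p (Fin.suc j)) i e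

countᵇ≡0 : ∀ {n} (p : Fin n → Bool) → (∀ i → p i ≡ false) → countᵇ p ≡ 0
countᵇ≡0 {zero}  p _   = refl
countᵇ≡0 {suc n} p all rewrite all Fin.zero = countᵇ≡0 (λ j → p (Fin.suc j)) (λ i → all (Fin.suc i))

countᵇ≤1 : ∀ {n} (p : Fin n → Bool) → (∀ i j → p i ≡ true → p j ≡ true → i ≡ j) → countᵇ p ≤ 1
countᵇ≤1 {zero}  p _ = z≤n
countᵇ≤1 {suc n} p unique with p Fin.zero in e₀
... | true  = ≤-reflexive (cong suc (countᵇ≡0 (λ j → p (Fin.suc j)) rest-false))
  where
  rest-false : ∀ i → p (Fin.suc i) ≡ false
  rest-false i = ¬-not λ eᵢ → case unique Fin.zero (Fin.suc i) e₀ eᵢ of λ ()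
... | false = countᵇ≤1 (λ j → p (Fin.suc j)) λ i j eᵢ eⱼ → Finₚ.suc-injective (unique _ _ eᵢ eⱼ)

∧-true⁻ : ∀ {x y} → (x ∧ y) ≡ true → x ≡ true × y ≡ true
∧-true⁻ {true} e = refl , e

bit : Bool → ℕ
bit b = if b then 1 else 0

countBelow : (ℕ → Bool) → ℕ → ℕ
countBelow p zero    = 0
countBelow p (suc n) = bit (p 0) + countBelow (λ u → p (suc u)) n

countBelow-suc : ∀ p n → countBelow p (suc n) ≡ countBelow p n + bit (p n)
countBelow-suc p zero    = +-identityʳ _
countBelow-suc p (suc n) = begin
  bit (p 0) + countBelow p′ (suc n)           ≡⟨ cong (bit (p 0) +_) (countBelow-suc p′ n) ⟩
  bit (p 0) + (countBelow p′ n + bit (p′ n))  ≡⟨ +-assoc (bit (p 0)) _ _ ⟨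
  countBelow p (suc n) + bit (p (suc n))      ∎
  where
  open ≡-Reasoning
  p′ : ℕ → Bool
  p′ u = p (suc u)

nth-filterᵇ-applyUpTo : ∀ (p : ℕ → Bool) f n j t → nth (filterᵇ p (applyUpTo f n)) j ≡ just t →
                        ∃ λ u → u < n × f u ≡ t × p t ≡ true × countBelow (λ v → p (f v)) u ≡ j
nth-filterᵇ-applyUpTo p f (suc n) j t e with p (f 0) in e₀
nth-filterᵇ-applyUpTo p f (suc n) zero    t refl | true = 0 , s≤s z≤n , refl , e₀ , refl
nth-filterᵇ-applyUpTo p f (suc n) (suc j) t e    | true
  with u , u<n , fu≡t , pt , count ← nth-filterᵇ-applyUpTo p (λ v → f (suc v)) n j t e
  = suc u , s≤s u<n , fu≡t , pt ,
    trans (cong (λ b → bit b + countBelow (λ v → p (f (suc v))) u) e₀) (cong suc count)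
nth-filterᵇ-applyUpTo p f (suc n) j       t e    | false
  with u , u<n , fu≡t , pt , count ← nth-filterᵇ-applyUpTo p (λ v → f (suc v)) n j t e
  = suc u , s≤s u<n , fu≡t , pt ,
    trans (cong (λ b → bit b + countBelow (λ v → p (f (suc v))) u) e₀) count

evenᵇ : ℕ → Bool
evenᵇ zero    = true
evenᵇ (suc n) = not (evenᵇ n)

evenᵇ-+bit : ∀ n b → evenᵇ (n + bit b) ≡ (if b then not (evenᵇ n) else evenᵇ n)
evenᵇ-+bit n true  rewrite +-comm n 1 = refl
evenᵇ-+bit n false rewrite +-identityʳ n = refl

odd-suc⇒evenᵇ : ∀ j → Odd (suc j) → evenᵇ j ≡ true
odd-suc⇒evenᵇ zero          _   = refl
odd-suc⇒evenᵇ (suc zero)    ()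
odd-suc⇒evenᵇ (suc (suc j)) odd rewrite odd-suc⇒evenᵇ j odd = refl

even⊎odd : ∀ n → Even n ⊎ Odd n
even⊎odd zero          = inj₁ refl
even⊎odd (suc zero)    = inj₂ refl
even⊎odd (suc (suc n)) = even⊎odd n

module _ {N : ℕ} (M : SignedMap N) where
  open SignedMap M

  private
    A R R⁻¹ φ : Fin N → Fin N
    A   = a M
    R   = r M
    R⁻¹ = r⁻¹ M
    φ y = R (A y)

    St : ℕ → Fin N × Bool
    St = state M

    twisted-at : ℕ → Bool
    twisted-at u = twist (edgeAt M u)

    corner : Fin N × Bool → Fin N
    corner (h , s) = if s then R⁻¹ h else h

  R∘R⁻¹ : ∀ h → R (R⁻¹ h) ≡ h
  R∘R⁻¹ h = inverseʳ ρ

  R⁻¹∘R : ∀ h → R⁻¹ (R h) ≡ h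
  R⁻¹∘R h = inverseˡ ρ

  R-injective : ∀ {x y} → R x ≡ R y → x ≡ y
  R-injective {x} {y} e = trans (sym (R⁻¹∘R x)) (trans (cong R⁻¹ e) (R⁻¹∘R y))

  precubic⇒R³≡id : Precubic M → ∀ h → R (R (R h)) ≡ h
  precubic⇒R³≡id (degrees , _) h with degrees h
  ... | inj₁ leaf rewrite leaf | leaf = leaf
  ... | inj₂ (_ , cubic) = cubic

  step-into-right : ∀ {z s h} → step M (z , s) ≡ (h , false) → z ≡ A (R h) × s ≡ twist z
  step-into-right {z} {s} e with twist z | s | e
  ... | true  | true  | refl = sym (trans (cong A (R∘R⁻¹ (A z))) (α-invol z)) , refl
  ... | false | false | refl = sym (trans (cong A (R∘R⁻¹ (A z))) (α-invol z)) , refl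

  step-into-left : ∀ {z s h} → step M (z , s) ≡ (h , true) → z ≡ A (R⁻¹ h) × s ≡ not (twist z)
  step-into-left {z} {s} e with twist z | s | e
  ... | true  | false | refl = sym (trans (cong A (R⁻¹∘R (A z))) (α-invol z)) , refl
  ... | false | true  | refl = sym (trans (cong A (R⁻¹∘R (A z))) (α-invol z)) , refl

  tour-into-right : ∀ u {h} → St (suc u) ≡ (h , false) → St u ≡ (A (R h) , twist (A (R h)))
  tour-into-right u e with z≡ , s≡ ← step-into-right e = cong₂ _,_ z≡ (trans s≡ (cong twist z≡))

  tour-into-left-across-twist : ∀ u {x} → St (suc u) ≡ (R x , true) → twist x ≡ true →
                                St u ≡ (A x , false)
  tour-into-left-across-twist u {x} e twisted with z≡ , s≡ ← step-into-left e =
    cong₂ _,_ z≡Ax (begin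
      proj₂ (St u)                ≡⟨ s≡ ⟩
      not (twist (proj₁ (St u)))  ≡⟨ cong (λ z → not (twist z)) z≡Ax ⟩
      not (twist (A x))           ≡⟨ cong not (trans (twist-α x) twisted) ⟩
      false                       ∎)
    where
    open ≡-Reasoning
    z≡Ax : proj₁ (St u) ≡ A x
    z≡Ax = trans z≡ (cong A (R⁻¹∘R x))

  tour-across-twist : ∀ u {z} → St u ≡ (z , true) → twist z ≡ true →
                      St (suc u) ≡ (R⁻¹ (A z) , false)
  tour-across-twist u e twisted rewrite e | twisted = refl

  left-or-right : ∀ τ → St τ ≡ (R (cornerAt M τ) , true) ⊎ St τ ≡ (cornerAt M τ , false)
  left-or-right τ = sides (St τ)
    where
    sides : ∀ p → p ≡ (R (corner p) , true) ⊎ p ≡ (corner p , false)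
    sides (h , true)  = inj₁ (cong (_, true) (sym (R∘R⁻¹ h)))
    sides (h , false) = inj₂ refl

  sameVertexᵇ-refl : 0 < N → ∀ y → sameVertexᵇ M y y ≡ true
  sameVertexᵇ-refl 0<N y = anyᵇ⁺ _ (fromℕ< 0<N) found
    where
    found : ⌊ iter R (toℕ (fromℕ< 0<N)) y ≟ y ⌋ ≡ true
    found rewrite toℕ-fromℕ< 0<N = trans (isYes≗does (y ≟ y)) (dec-true (y ≟ y) refl)

  corners-at-vertex : (∀ h → R (R (R h)) ≡ h) → ∀ {y c} → sameVertexᵇ M y (R c) ≡ true →
                      y ≡ c ⊎ y ≡ R c ⊎ y ≡ R (R c)
  corners-at-vertex R³≡id {y} {c} same with i , eᵢ ← anyᵇ⁻ {N} _ same
    with iter-order3 R R³≡id (toℕ i) y | ⌊≟⌋≡true⇒≡ eᵢ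
  ... | inj₁ e        | e′ = inj₂ (inj₁ (trans (sym e) e′))
  ... | inj₂ (inj₁ e) | e′ = inj₁ (R-injective (trans (sym e) e′))
  ... | inj₂ (inj₂ e) | e′ = inj₂ (inj₂ (trans (sym (R³≡id y)) (cong R (trans (sym e) e′))))

  walk-back-along-face : ∀ {τ x} J → St τ ≡ (x , false) →
                         (∀ j → j < J → twist (iter φ j (R x)) ≡ false) →
                         ∃ λ τ′ → τ′ ≤ τ × ∃ λ g → St τ′ ≡ (g , false) × R g ≡ iter φ J (R x)
  walk-back-along-face {τ} {x} zero right _ = τ , ≤-refl , x , right , refl
  walk-back-along-face {x = x} (suc J) right untwisted
    with walk-back-along-face J right (λ j j<J → untwisted j (m<n⇒m<1+n j<J))
  ... | zero  , _     , _ , () , _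
  ... | suc u , 1+u≤τ , g , right′ , Rg≡y =
    u , ≤-trans (n≤1+n u) 1+u≤τ , A y , right″ , refl
    where
    y : Fin N
    y = iter φ J (R x)

    right″ : St u ≡ (A y , false)
    right″ = begin
      St u                          ≡⟨ tour-into-right u right′ ⟩
      (A (R g) , twist (A (R g)))   ≡⟨ cong (λ z → A z , twist (A z)) Rg≡y ⟩
      (A y , twist (A y))           ≡⟨ cong (A y ,_) untwisted-Ay ⟩
      (A y , false)                 ∎
      where
      open ≡-Reasoning
      untwisted-Ay : twist (A y) ≡ false
      untwisted-Ay = trans (twist-α y) (untwisted J (n<1+n J))

  odd-bud : ∀ j → Odd (suc j) → bud M (suc j) ≡ Maybe.map (edgeAt M) (nth (twistTimes M) j)
  odd-bud j odd rewrite odd = refl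

  leftAt-parity : ∀ u → leftAt M u ≡ evenᵇ (countBelow twisted-at u)
  leftAt-parity zero    = refl
  leftAt-parity (suc u) = begin
    flip-if (twisted-at u) (leftAt M u)    ≡⟨ cong (flip-if (twisted-at u)) (leftAt-parity u) ⟩
    flip-if (twisted-at u) (evenᵇ n)       ≡⟨ evenᵇ-+bit n (twisted-at u) ⟨
    evenᵇ (n + bit (twisted-at u))         ≡⟨ cong evenᵇ (countBelow-suc twisted-at u) ⟨
    evenᵇ (countBelow twisted-at (suc u))  ∎
    where
    open ≡-Reasoning
    n : ℕ
    n = countBelow twisted-at u

    flip-if : Bool → Bool → Bool
    flip-if b l = if b then not l else l

  odd-bud-is-twist-exit : ∀ j {x} → Odd (suc j) → bud M (suc j) ≡ just x →
                          ∃ λ t → t < N × St t ≡ (x , true) × twist x ≡ true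
  odd-bud-is-twist-exit j odd bud≡x
    with nth (twistTimes M) j in nth≡t | trans (sym (odd-bud j odd)) bud≡x
  ... | just t | refl
    with t , t<N , refl , twisted , count ← nth-filterᵇ-applyUpTo twisted-at id N j t nth≡t =
    t , t<N , cong (edgeAt M t ,_) left , twisted
    where
    left : leftAt M t ≡ true
    left = trans (leftAt-parity t) (trans (cong evenᵇ count) (odd-suc⇒evenᵇ j odd))

  module _ (unicellular : Unicellular M) where

    visit-unique : ∀ {t t'} → t < N → t' < N → cornerAt M t ≡ cornerAt M t' → t ≡ t'
    visit-unique {t} {t'} t<N t'<N e = begin
      t                     ≡⟨ toℕ-fromℕ< t<N ⟨
      toℕ (fromℕ< t<N)      ≡⟨ cong toℕ (unicellular _ _ e′) ⟩
      toℕ (fromℕ< t'<N)     ≡⟨ toℕ-fromℕ< t'<N ⟩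
      t'                    ∎
      where
      open ≡-Reasoning
      e′ : cornerAt M (toℕ (fromℕ< t<N)) ≡ cornerAt M (toℕ (fromℕ< t'<N))
      e′ rewrite toℕ-fromℕ< t<N | toℕ-fromℕ< t'<N = e

    visit : ∀ c → ∃ λ τ → τ < N × (St τ ≡ (R c , true) ⊎ St τ ≡ (c , false))
    visit c with i , eᵢ ← injective⇒surjective (λ {i} {j} → unicellular i j) c =
      toℕ i , toℕ<n i , subst visited eᵢ (left-or-right (toℕ i))
      where
      visited : Fin N → Set
      visited c′ = St (toℕ i) ≡ (R c′ , true) ⊎ St (toℕ i) ≡ (c′ , false)

    ¬left∧right : ∀ {τ τ' c} → τ < N → τ' < N → St τ ≡ (R c , true) → St τ' ≡ (c , false) → ⊥
    ¬left∧right {c = c} τ<N τ'<N left right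
      with refl ← visit-unique τ<N τ'<N
                    (trans (cong corner left) (trans (R⁻¹∘R c) (sym (cong corner right))))
      with () ← trans (sym left) right

    ¬left-corners-across-twist : ∀ {τ τ' x} → τ < N → τ' < N → twist x ≡ true →
                                 St τ ≡ (R x , true) → St τ' ≡ (R (A x) , true) → ⊥
    ¬left-corners-across-twist {zero}   {zero}    {x} _   _    _       left left′ =
      α-free x (R-injective (cong proj₁ (trans (sym left′) left)))
    ¬left-corners-across-twist {suc τ}  {τ'}      {x} τ<N τ'<N twisted left left′ =
      ¬left∧right τ'<N (<⇒≤ τ<N) left′ (tour-into-left-across-twist τ left twisted)
    ¬left-corners-across-twist {zero}   {suc τ'}  {x} τ<N τ'<N twisted left left′ =
      ¬left∧right τ<N (<⇒≤ τ'<N) left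
        (subst (λ y → St τ' ≡ (y , false)) (α-invol x)
          (tour-into-left-across-twist τ' left′ (trans (twist-α x) twisted)))

    ¬left-exits-across-twist : ∀ {t τ x} → t < N → suc τ < N → twist x ≡ true →
                               St t ≡ (x , true) → St τ ≡ (A x , true) → ⊥
    ¬left-exits-across-twist {t} {τ} {x} t<N 1+τ<N twisted exit exit′ =
      ¬left∧right t<N 1+τ<N
        (trans exit (cong (_, true) (sym (trans (R∘R⁻¹ _) (α-invol x)))))
        (tour-across-twist τ exit′ (trans (twist-α x) twisted))

    twist-exit-lands-right : ∀ {t x} → t < N → St t ≡ (x , true) → twist x ≡ true →
                             ∃ λ τ → τ < N × St τ ≡ (R⁻¹ (A x) , false)
    twist-exit-lands-right {t} {x} t<N exit twisted with m≤n⇒m<n∨m≡n t<N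
    ... | inj₁ 1+t<N = suc t , 1+t<N , tour-across-twist t exit twisted
    -- the tour ends right after t, so the corner R⁻¹ (A x) is located by unicellularity
    ... | inj₂ 1+t≡N with visit (R⁻¹ (A x))
    ...   | τ , τ<N , inj₂ right = τ , τ<N , right
    ...   | τ , τ<N , inj₁ left =
      ⊥-elim (¬second-exit (trans left (cong (_, true) (R∘R⁻¹ (A x)))))
      where
      ¬second-exit : St τ ≡ (A x , true) → ⊥
      ¬second-exit exit′ with m≤n⇒m<n∨m≡n τ<N
      ... | inj₁ 1+τ<N = ¬left-exits-across-twist t<N 1+τ<N twisted exit exit′
      ... | inj₂ 1+τ≡N = α-free x (cong proj₁ (trans (sym exit′) (trans (cong St τ≡t) exit)))
        where
        τ≡t : τ ≡ t
        τ≡t = suc-injective (trans 1+τ≡N (sym 1+t≡N))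

    ¬left-exit-at-next-bud : ∀ {τ t' x x'} → τ < N → t' < N → St τ ≡ (x , false) →
                              St t' ≡ (x' , true) → NextBud M x x' → ⊥
    ¬left-exit-at-next-bud τ<N t'<N right exit (J , φᴶ≡x' , _ , untwisted)
      with τ′ , τ′≤τ , g , right′ , Rg≡ ← walk-back-along-face J right untwisted =
      ¬left∧right t'<N (≤-<-trans τ′≤τ τ<N)
        (trans exit (cong (_, true) (sym (trans Rg≡ φᴶ≡x')))) right′

    module _ (R³≡id : ∀ h → R (R (R h)) ≡ h) (canonical : Canonical M) where

      ¬adjacent-right-corners : ∀ {τ₁ τ₂ c} → τ₁ < N → τ₂ < N →
                                St τ₁ ≡ (c , false) → St τ₂ ≡ (R c , false) → ⊥
      -- A left corner at the vertex of R c can only be R (R c), so there is at most one.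
      ¬adjacent-right-corners {τ₁} {τ₂} {c} τ₁<N τ₂<N right₁ right₂ = <-irrefl refl (begin-strict
        rightCount M (R c)  <⟨ canonical (R c) ⟩
        leftCount M (R c)   ≤⟨ countᵇ≤1 _ left-times-equal ⟩
        1                   ≤⟨ 1≤countᵇ _ (fromℕ< τ₂<N) right-corner ⟩
        rightCount M (R c)  ∎)
        where
        open ≤-Reasoning

        left-visit : ℕ → Fin N → Set
        left-visit τ y = St τ ≡ (R y , true)

        τ₂′ : ℕ
        τ₂′ = toℕ (fromℕ< τ₂<N)

        right-corner : (sameVertexᵇ M (cornerAt M τ₂′) (R c) ∧ not (leftAt M τ₂′)) ≡ true
        right-corner rewrite toℕ-fromℕ< τ₂<N | cong corner right₂ | cong proj₂ right₂
          | sameVertexᵇ-refl (≤-<-trans z≤n τ₂<N) (R c) = refl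

        left-at-vertex : Fin N → Bool
        left-at-vertex u = sameVertexᵇ M (cornerAt M (toℕ u)) (R c) ∧ leftAt M (toℕ u)

        left-corner : ∀ u → left-at-vertex u ≡ true → cornerAt M (toℕ u) ≡ R (R c)
        left-corner u e with same , left ← ∧-true⁻ e
          with left-or-right (toℕ u) | corners-at-vertex R³≡id same
        ... | inj₂ right | _              = contradiction (trans (sym left) (cong proj₂ right)) λ ()
        ... | inj₁ left′ | inj₁ e′        =
          ⊥-elim (¬left∧right (toℕ<n u) τ₁<N (subst (left-visit (toℕ u)) e′ left′) right₁)
        ... | inj₁ left′ | inj₂ (inj₁ e′) =
          ⊥-elim (¬left∧right (toℕ<n u) τ₂<N (subst (left-visit (toℕ u)) e′ left′) right₂)
        ... | inj₁ _     | inj₂ (inj₂ e′) = e′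

        left-times-equal : ∀ u v → left-at-vertex u ≡ true → left-at-vertex v ≡ true → u ≡ v
        left-times-equal u v eᵤ eᵥ = unicellular u v (trans (left-corner u eᵤ) (sym (left-corner v eᵥ)))

      twist-exit-corner-is-right : ∀ {t x} → t < N → St t ≡ (x , true) → twist x ≡ true →
                                   ∃ λ τ → τ < N × St τ ≡ (x , false)
      twist-exit-corner-is-right {t} {x} t<N exit twisted with visit x
      ... | τ , τ<N , inj₂ right = τ , τ<N , right
      ... | τ , τ<N , inj₁ left with visit (A x)
      ...   | τ′ , τ′<N , inj₁ left′  = ⊥-elim (¬left-corners-across-twist τ<N τ′<N twisted left left′)
      ...   | τ′ , τ′<N , inj₂ right′
        with τ″ , τ″<N , right″ ← twist-exit-lands-right t<N exit twisted =
        ⊥-elim (¬adjacent-right-corners τ″<N τ′<N right″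
                  (trans right′ (cong (_, false) (sym (R∘R⁻¹ (A x))))))

      σ-odd⇒even : ∀ i i' → Sigma M i i' → Odd i → Even i'
      σ-odd⇒even zero    _        (_ , _ , () , _)
      σ-odd⇒even _       zero     (_ , _ , _ , () , _)
      σ-odd⇒even (suc j) (suc j') (x , x' , bud≡x , bud≡x' , next) odd with even⊎odd (suc j')
      ... | inj₁ even = even
      ... | inj₂ odd′
        with t  , t<N  , exit  , twisted ← odd-bud-is-twist-exit j odd bud≡x
        with t' , t'<N , exit′ , _       ← odd-bud-is-twist-exit j' odd′ bud≡x'
        with τ  , τ<N  , right           ← twist-exit-corner-is-right t<N exit twisted =
        ⊥-elim (¬left-exit-at-next-bud τ<N t'<N right exit′ next)

      σ⁻¹[1]-even : ∀ r → Sigma M r 1 → Even r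
      σ⁻¹[1]-even r σr≡1 with even⊎odd r
      ... | inj₁ even = even
      ... | inj₂ odd with () ← σ-odd⇒even r 1 σr≡1 odd

lemma4p2 : ∀ {N : ℕ} (M : SignedMap N) (k : ℕ) →
    Connected M → Unicellular M → Precubic M → NonOrientable M →
    Canonical M → HasTwists M k → 1 ≤ k →
    (∀ i i' → 1 ≤ i → i ≤ 2 * k → 1 ≤ i' → i' ≤ 2 * k →
       Sigma M i i' → Odd i → Even i')
    × (∀ r → 1 ≤ r → r ≤ 2 * k → Sigma M r 1 → Even r)
lemma4p2 M k _ unicellular precubic _ canonical _ _ =
  (λ i i' _ _ _ _ → σ-odd⇒even M unicellular R³≡id canonical i i') ,
  (λ r _ _ → σ⁻¹[1]-even M unicellular R³≡id canonical r)
  where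
  R³≡id : ∀ h → r M (r M (r M h)) ≡ h
  R³≡id = precubic⇒R³≡id M precubic
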